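{- A matroid $L$ on $E$ is irreducible if and only if, for each ordered pair $x,y$ of distinct elements of $E$, there is a cyclic flat $Z$ of $L$ with $x\in Z$ and $y\notin Z$.
   Context: For $A,B\subseteq E$ with $A\cup B=E$, $(A,B)$ is a free separator of $L$ if $L=L|A\mathbin{\Join} L.B$, where $L.B=L/(E-B)$ and, for matched $M(A)$, $N(B)$ (i.e. $M.(A\cap B)=N|(A\cap B)$), the free splice $M\mathbin{\Join} N$ is the matroid on $A\cup B$ with rank $r(X)=\min\{r_M(X\cap A)+|X-A|,\ r_N(X\cap B)+r_M(A-B)\}$. A free separator is nontrivial if $A-B$ and $B-A$ are both nonempty; $L$ is reducible if it has a nontrivial free separator and irreducible otherwise. A cyclic flat is a flat that is a union of circuits. -}

module Defs where

open import Data.Nat using (ℕ; _+_; _∸_; _≤_; _<_; _⊓_)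
open import Data.Fin using (Fin)
open import Data.Fin.Subset using (Subset; _∪_; _∩_; _─_; ∁; ⁅_⁆; ∣_∣; _∈_; _∉_; _⊆_; _⊂_; Nonempty)
  renaming (⊤ to Full)
open import Data.Product using (Σ; ∃; _×_)
open import Relation.Binary.PropositionalEquality using (_≡_)
open import Relation.Nullary using (¬_)

record Matroid (n : ℕ) : Set where
  field
    rank     : Subset n → ℕ
    rank-≤   : ∀ X → rank X ≤ ∣ X ∣
    rank-mon : ∀ X Y → X ⊆ Y → rank X ≤ rank Y
    rank-sub : ∀ X Y → rank (X ∪ Y) + rank (X ∩ Y) ≤ rank X + rank Y
open Matroid public

-- Rank functions on subsets of E; a rank function of a matroid on a subset
-- A ⊆ E is represented by a function that is only consulted on subsets of A.
RankFn : ℕ → Set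
RankFn n = Subset n → ℕ

restrictRk : ∀ {n} → RankFn n → Subset n → RankFn n
restrictRk r A Y = r (Y ∩ A)

-- rank function of the contraction M/C  (meaningful on subsets of the ground set minus C)
contractRk : ∀ {n} → RankFn n → Subset n → RankFn n
contractRk r C Y = r (Y ∪ C) ∸ r C

-- rank function of L.B = L/(E-B)  (meaningful on subsets of B)
dotRk : ∀ {n} → RankFn n → Subset n → RankFn n
dotRk r B Y = contractRk r (∁ B) (Y ∩ B)

-- M on A and N on B are matched: M.(A∩B) = N|(A∩B), where
-- M.(A∩B) = M/(A-(A∩B)) = M/(A-B).
Matched : ∀ {n} → RankFn n → RankFn n → Subset n → Subset n → Set
Matched rM rN A B = ∀ Y → Y ⊆ A ∩ B → contractRk rM (A ─ B) Y ≡ rN Y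

freeSpliceRk : ∀ {n} → RankFn n → RankFn n → Subset n → Subset n → RankFn n
freeSpliceRk rM rN A B X =
  (rM (X ∩ A) + ∣ X ─ A ∣) ⊓ (rN (X ∩ B) + rM (A ─ B))

FreeSeparator : ∀ {n} → Matroid n → Subset n → Subset n → Set
FreeSeparator L A B =
  (A ∪ B ≡ Full)
  × Matched (restrictRk (rank L) A) (dotRk (rank L) B) A B
  × (∀ X → rank L X ≡ freeSpliceRk (restrictRk (rank L) A) (dotRk (rank L) B) A B X)

NontrivialFreeSeparator : ∀ {n} → Matroid n → Subset n → Subset n → Set
NontrivialFreeSeparator L A B =
  FreeSeparator L A B × Nonempty (A ─ B) × Nonempty (B ─ A)

Reducible : ∀ {n} → Matroid n → Set
Reducible L = ∃ λ A → ∃ λ B → NontrivialFreeSeparator L A B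

Irreducible : ∀ {n} → Matroid n → Set
Irreducible L = ¬ Reducible L

Independent : ∀ {n} → Matroid n → Subset n → Set
Independent L X = rank L X ≡ ∣ X ∣

Dependent : ∀ {n} → Matroid n → Subset n → Set
Dependent L X = rank L X < ∣ X ∣

Circuit : ∀ {n} → Matroid n → Subset n → Set
Circuit L C = Dependent L C × (∀ D → D ⊂ C → Independent L D)

Flat : ∀ {n} → Matroid n → Subset n → Set
Flat L Z = ∀ e → e ∉ Z → rank L Z < rank L (Z ∪ ⁅ e ⁆)

UnionOfCircuits : ∀ {n} → Matroid n → Subset n → Set
UnionOfCircuits L Z = ∀ e → e ∈ Z → ∃ λ C → Circuit L C × C ⊆ Z × e ∈ C

CyclicFlat : ∀ {n} → Matroid n → Subset n → Set
CyclicFlat L Z = Flat L Z × UnionOfCircuits L Z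

-- If (A, B) is a nontrivial free separator with y ∈ A − B and x ∈ B − A, then evaluating the
-- splice rank formula on a circuit C through x (which is not contained in A, so C ∩ A is
-- independent) gives r (C ∪ (E − B)) = r C: the circuit spans E − B ∋ y. Hence a flat that is
-- a union of circuits and contains x also contains y.
-- Conversely, for x ≠ y the pair (E − x, E − y) is a free separator as soon as y ∈ cl X for
-- every X ∋ x in which x is not a coloop. If L is irreducible there is therefore such an X
-- with y ∉ cl X. Closing X keeps both properties and makes it a flat; deleting coloops one at a
-- time keeps it a flat in which x is not a coloop and y is absent, and a flat without coloops
-- is cyclic.
module Submission where

open import Defs
open import Data.Nat using (ℕ; zero; suc; _+_; _∸_; _≤_; _<_; _⊓_; _≤?_; _<?_; s≤s⁻¹)
open import Data.Nat.Properties
open import Data.Bool.Properties using (not-involutive)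
open import Data.Fin using (Fin) renaming (_≟_ to _≟ᶠ_)
open import Data.Fin.Properties using (any?)
open import Data.Fin.Subset
open import Data.Fin.Subset.Properties
open import Data.Vec using ([]; _∷_; there)
open import Data.Product using (∃; _×_; _,_; proj₁; proj₂; curry)
open import Data.Sum using (inj₁; inj₂; [_,_]′)
open import Function using (_∘_)
open import Function.Bundles using (_⇔_; mk⇔; Equivalence)
open import Relation.Nullary using (¬_; Dec; yes; no; contradiction)
open import Relation.Nullary.Decidable using (¬?; _×-dec_; decidable-stable)
open import Relation.Binary.PropositionalEquality
  using (_≡_; _≢_; refl; sym; trans; cong; cong₂; subst; module ≡-Reasoning)

private variable
  n : ℕ
  x y e f g : Fin n
  p q X Y Z C : Subset n

x∈p─q⇒x∉q : ∀ (p q : Subset n) → x ∈ p ─ q → x ∉ q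
x∈p─q⇒x∉q (_ ∷ p) (_ ∷ q) (there x∈p─q) (there x∈q) = x∈p─q⇒x∉q p q x∈p─q x∈q

x∈p-y⇒x≢y : ∀ (p : Subset n) → x ∈ p - y → x ≢ y
x∈p-y⇒x≢y {x = x} p x∈p-y refl = x∈p─q⇒x∉q p ⁅ x ⁆ x∈p-y (x∈⁅x⁆ x)

x∈p∪⁅x⁆ : ∀ (p : Subset n) → x ∈ p ∪ ⁅ x ⁆
x∈p∪⁅x⁆ {x = x} p = x∈p∪q⁺ (inj₂ (x∈⁅x⁆ x))

p⊆p-x∪⁅x⁆ : p ⊆ (p - x) ∪ ⁅ x ⁆
p⊆p-x∪⁅x⁆ {x = x} {i} i∈p with i ≟ᶠ x
... | yes refl = x∈p∪⁅x⁆ _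
... | no i≢x   = x∈p∪q⁺ (inj₁ (x∈p∧x≢y⇒x∈p-y i∈p i≢x))

p⊆q∪p─q : ∀ (q : Subset n) → p ⊆ q ∪ (p ─ q)
p⊆q∪p─q q {i} i∈p with i ∈? q
... | yes i∈q = x∈p∪q⁺ (inj₁ i∈q)
... | no i∉q  = x∈p∪q⁺ (inj₂ (x∈p∧x∉q⇒x∈p─q i∈p i∉q))

p⊆q⇒p-x⊆q-x : p ⊆ q → p - x ⊆ q - x
p⊆q⇒p-x⊆q-x {p = p} p⊆q h = x∈p∧x≢y⇒x∈p-y (p⊆q (p─q⊆p p _ h)) (x∈p-y⇒x≢y p h)

p⊆p-x∪p-y : y ≢ x → p ⊆ (p - x) ∪ (p - y)
p⊆p-x∪p-y {y = y} {x = x} y≢x {i} i∈p with i ≟ᶠ x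
... | yes refl = x∈p∪q⁺ (inj₂ (x∈p∧x≢y⇒x∈p-y i∈p (y≢x ∘ sym)))
... | no i≢x   = x∈p∪q⁺ (inj₁ (x∈p∧x≢y⇒x∈p-y i∈p i≢x))

p-x-y⊆p-y∩p-x : p - x - y ⊆ (p - y) ∩ (p - x)
p-x-y⊆p-y∩p-x {p = p} h = x∈p∩q⁺ (p⊆q⇒p-x⊆q-x (p─q⊆p p _) h , p─q⊆p _ _ h)

∪-mono-⊆ : ∀ {p′ q′ : Subset n} → p ⊆ p′ → q ⊆ q′ → p ∪ q ⊆ p′ ∪ q′
∪-mono-⊆ {p = p} {q = q} p⊆p′ q⊆q′ h with x∈p∪q⁻ p q h
... | inj₁ i∈p = x∈p∪q⁺ (inj₁ (p⊆p′ i∈p))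
... | inj₂ i∈q = x∈p∪q⁺ (inj₂ (q⊆q′ i∈q))

x∈p⇒⁅x⁆⊆p : x ∈ p → ⁅ x ⁆ ⊆ p
x∈p⇒⁅x⁆⊆p {x = x} {p = p} x∈p i∈⁅x⁆ = subst (_∈ p) (sym (x∈⁅y⁆⇒x≡y x i∈⁅x⁆)) x∈p

p⊆q∧x∉p⇒p⊆q-x : p ⊆ q → x ∉ p → p ⊆ q - x
p⊆q∧x∉p⇒p⊆q-x p⊆q x∉p i∈p = x∈p∧x≢y⇒x∈p-y (p⊆q i∈p) λ { refl → x∉p i∈p }

p-x≡p : x ∉ p → p - x ≡ p
p-x≡p {p = p} x∉p = ⊆-antisym (p─q⊆p p _) (p⊆q∧x∉p⇒p⊆q-x ⊆-refl x∉p)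

p∪⁅x⁆-x≡p : x ∉ p → (p ∪ ⁅ x ⁆) - x ≡ p
p∪⁅x⁆-x≡p {x = x} {p = p} x∉p = ⊆-antisym forward (p⊆q∧x∉p⇒p⊆q-x (p⊆p∪q _) x∉p)
  where
  forward : (p ∪ ⁅ x ⁆) - x ⊆ p
  forward h with x∈p∪q⁻ p ⁅ x ⁆ (p─q⊆p _ _ h)
  ... | inj₁ i∈p   = i∈p
  ... | inj₂ i∈⁅x⁆ = contradiction (x∈⁅y⁆⇒x≡y x i∈⁅x⁆) (x∈p-y⇒x≢y _ h)

p∩⁅x⁆≡⁅x⁆ : x ∈ p → p ∩ ⁅ x ⁆ ≡ ⁅ x ⁆
p∩⁅x⁆≡⁅x⁆ {p = p} x∈p = ⊆-antisym (p∩q⊆q p _) (λ i∈⁅x⁆ → x∈p∩q⁺ (x∈p⇒⁅x⁆⊆p x∈p i∈⁅x⁆ , i∈⁅x⁆))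

p∩⁅x⁆≡⊥ : x ∉ p → p ∩ ⁅ x ⁆ ≡ ⊥
p∩⁅x⁆≡⊥ {x = x} {p = p} x∉p = ⊆-antisym
  (λ h → let i∈p , i∈⁅x⁆ = x∈p∩q⁻ p _ h in contradiction (subst (_∈ p) (x∈⁅y⁆⇒x≡y x i∈⁅x⁆) i∈p) x∉p)
  ⊥⊆

∣p∣≡∣p∩q∣+∣p─q∣ : ∀ (p q : Subset n) → ∣ p ∣ ≡ ∣ p ∩ q ∣ + ∣ p ─ q ∣
∣p∣≡∣p∩q∣+∣p─q∣ []            []            = refl
∣p∣≡∣p∩q∣+∣p─q∣ (inside  ∷ p) (inside  ∷ q) = cong suc (∣p∣≡∣p∩q∣+∣p─q∣ p q)
∣p∣≡∣p∩q∣+∣p─q∣ (inside  ∷ p) (outside ∷ q) =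
  trans (cong suc (∣p∣≡∣p∩q∣+∣p─q∣ p q)) (sym (+-suc _ _))
∣p∣≡∣p∩q∣+∣p─q∣ (outside ∷ p) (inside  ∷ q) = ∣p∣≡∣p∩q∣+∣p─q∣ p q
∣p∣≡∣p∩q∣+∣p─q∣ (outside ∷ p) (outside ∷ q) = ∣p∣≡∣p∩q∣+∣p─q∣ p q

∣p∣≡1+∣p-x∣ : x ∈ p → ∣ p ∣ ≡ suc ∣ p - x ∣
∣p∣≡1+∣p-x∣ {x = x} {p = p} x∈p = begin
  ∣ p ∣                       ≡⟨ ∣p∣≡∣p∩q∣+∣p─q∣ p ⁅ x ⁆ ⟩
  ∣ p ∩ ⁅ x ⁆ ∣ + ∣ p - x ∣   ≡⟨ cong (λ s → ∣ s ∣ + ∣ p - x ∣) (p∩⁅x⁆≡⁅x⁆ x∈p) ⟩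
  ∣ ⁅ x ⁆ ∣ + ∣ p - x ∣       ≡⟨ cong (_+ ∣ p - x ∣) (∣⁅x⁆∣≡1 x) ⟩
  suc ∣ p - x ∣               ∎
  where open ≡-Reasoning

∣p∪⁅x⁆∣≡1+∣p∣ : x ∉ p → ∣ p ∪ ⁅ x ⁆ ∣ ≡ suc ∣ p ∣
∣p∪⁅x⁆∣≡1+∣p∣ {p = p} x∉p =
  trans (∣p∣≡1+∣p-x∣ (x∈p∪⁅x⁆ p)) (cong (suc ∘ ∣_∣) (p∪⁅x⁆-x≡p x∉p))

∁-involutive : ∀ (p : Subset n) → ∁ (∁ p) ≡ p
∁-involutive []      = refl
∁-involutive (s ∷ p) = cong₂ _∷_ (not-involutive s) (∁-involutive p)

p∩∁q≡p─q : ∀ (p q : Subset n) → p ∩ ∁ q ≡ p ─ q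
p∩∁q≡p─q []            []            = refl
p∩∁q≡p─q (inside  ∷ p) (inside  ∷ q) = cong (outside ∷_) (p∩∁q≡p─q p q)
p∩∁q≡p─q (inside  ∷ p) (outside ∷ q) = cong (inside ∷_) (p∩∁q≡p─q p q)
p∩∁q≡p─q (outside ∷ p) (inside  ∷ q) = cong (outside ∷_) (p∩∁q≡p─q p q)
p∩∁q≡p─q (outside ∷ p) (outside ∷ q) = cong (outside ∷_) (p∩∁q≡p─q p q)

p─∁q≡p∩q : ∀ (p q : Subset n) → p ─ ∁ q ≡ p ∩ q
p─∁q≡p∩q p q = trans (sym (p∩∁q≡p─q p (∁ q))) (cong (p ∩_) (∁-involutive q))

p∩q∩q≡p∩q : ∀ (p q : Subset n) → (p ∩ q) ∩ q ≡ p ∩ q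
p∩q∩q≡p∩q p q = trans (∩-assoc p q q) (cong (p ∩_) (∩-idem q))

p∩q∪∁q≡p∪∁q : ∀ (p q : Subset n) → p ∩ q ∪ ∁ q ≡ p ∪ ∁ q
p∩q∪∁q≡p∪∁q p q = ⊆-antisym forward backward
  where
  forward : p ∩ q ∪ ∁ q ⊆ p ∪ ∁ q
  forward h with x∈p∪q⁻ (p ∩ q) (∁ q) h
  ... | inj₁ i∈p∩q = x∈p∪q⁺ (inj₁ (p∩q⊆p p q i∈p∩q))
  ... | inj₂ i∈∁q  = x∈p∪q⁺ (inj₂ i∈∁q)
  backward : p ∪ ∁ q ⊆ p ∩ q ∪ ∁ q
  backward {i} h with i ∈? q | x∈p∪q⁻ p (∁ q) h
  ... | yes i∈q | inj₁ i∈p  = x∈p∪q⁺ (inj₁ (x∈p∩q⁺ (i∈p , i∈q)))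
  ... | yes i∈q | inj₂ i∈∁q = x∈p∪q⁺ (inj₂ i∈∁q)
  ... | no i∉q  | _         = x∈p∪q⁺ (inj₂ (x∉p⇒x∈∁p i∉q))

p∪q≡⊤∧x∉q⇒x∈p : p ∪ q ≡ ⊤ → x ∉ q → x ∈ p
p∪q≡⊤∧x∉q⇒x∈p {p = p} {q = q} {x = x} p∪q≡⊤ x∉q
  with x∈p∪q⁻ p q (subst (x ∈_) (sym p∪q≡⊤) ∈⊤)
... | inj₁ x∈p = x∈p
... | inj₂ x∈q = contradiction x∈q x∉q

p∪q≡⊤⇒[p─q]∩p≡∁q : p ∪ q ≡ ⊤ → (p ─ q) ∩ p ≡ ∁ q
p∪q≡⊤⇒[p─q]∩p≡∁q {p = p} {q = q} p∪q≡⊤ = ⊆-antisym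
  (λ h → x∉p⇒x∈∁p (x∈p─q⇒x∉q p q (proj₁ (x∈p∩q⁻ (p ─ q) p h))))
  (λ h → let i∉q = x∈∁p⇒x∉p h ; i∈p = p∪q≡⊤∧x∉q⇒x∈p p∪q≡⊤ i∉q
         in x∈p∩q⁺ (x∈p∧x∉q⇒x∈p─q i∈p i∉q , i∈p))

∁⁅x⁆∪∁⁅y⁆≡⊤ : x ≢ y → ∁ ⁅ x ⁆ ∪ ∁ ⁅ y ⁆ ≡ ⊤
∁⁅x⁆∪∁⁅y⁆≡⊤ {x = x} {y = y} x≢y = ⊆-antisym ⊆⊤ ⊤⊆
  where
  ⊤⊆ : ⊤ ⊆ ∁ ⁅ x ⁆ ∪ ∁ ⁅ y ⁆
  ⊤⊆ {i} _ with i ≟ᶠ x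
  ... | yes refl = x∈p∪q⁺ (inj₂ (x∉p⇒x∈∁p (x≢y⇒x∉⁅y⁆ x≢y)))
  ... | no i≢x   = x∈p∪q⁺ (inj₁ (x∉p⇒x∈∁p (x≢y⇒x∉⁅y⁆ i≢x)))

y∈∁⁅x⁆─∁⁅y⁆ : y ≢ x → y ∈ ∁ ⁅ x ⁆ ─ ∁ ⁅ y ⁆
y∈∁⁅x⁆─∁⁅y⁆ {y = y} y≢x =
  x∈p∧x∉q⇒x∈p─q (x∉p⇒x∈∁p (x≢y⇒x∉⁅y⁆ y≢x)) (x∈p⇒x∉∁p (x∈⁅x⁆ y))

descend : (P : Subset n → Set) (R : Subset n → Fin n → Set) → (∀ X f → Dec (R X f)) →
          (∀ {X f} → P X → R X f → P (X - f)) →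
          P X → ∃ λ Z → Z ⊆ X × P Z × (∀ f → f ∈ Z → ¬ R Z f)
descend {X = X} P R R? step = go _ X ≤-refl
  where
  go : ∀ k X → ∣ X ∣ ≤ k → P X → ∃ λ Z → Z ⊆ X × P Z × (∀ f → f ∈ Z → ¬ R Z f)
  go k X ∣X∣≤k PX with any? (λ f → f ∈? X ×-dec R? X f)
  ... | no none = X , ⊆-refl , PX , λ f f∈X Rf → none (f , f∈X , Rf)
  go zero X ∣X∣≤0 PX | yes (f , f∈X , _) = contradiction (≤-trans (x∈p⇒∣p-x∣<∣p∣ f∈X) ∣X∣≤0) n≮0
  go (suc k) X ∣X∣≤1+k PX | yes (f , f∈X , Rf)
    with go k (X - f) (≤-pred (≤-trans (x∈p⇒∣p-x∣<∣p∣ f∈X) ∣X∣≤1+k)) (step PX Rf)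
  ... | Z , Z⊆X-f , PZ , minimal = Z , p─q⊆p X ⁅ f ⁆ ∘ Z⊆X-f , PZ , minimal

ascend : (P : Subset n → Set) (R : Subset n → Fin n → Set) → (∀ X e → Dec (R X e)) →
         (∀ {X e} → P X → R X e → P (X ∪ ⁅ e ⁆)) →
         P X → ∃ λ Z → P Z × (∀ e → e ∉ Z → ¬ R Z e)
ascend {n = n} {X = X} P R R? step = go n X (m≤n+m n ∣ X ∣)
  where
  go : ∀ k X → n ≤ ∣ X ∣ + k → P X → ∃ λ Z → P Z × (∀ e → e ∉ Z → ¬ R Z e)
  go k X n≤∣X∣+k PX with any? (λ e → ¬? (e ∈? X) ×-dec R? X e)
  ... | no none = X , PX , λ e e∉X Re → none (e , e∉X , Re)
  go zero X n≤∣X∣+0 PX | yes (e , e∉X , _) = contradiction (begin-strict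
    ∣ X ∣           <⟨ n<1+n _ ⟩
    suc ∣ X ∣       ≡⟨ ∣p∪⁅x⁆∣≡1+∣p∣ e∉X ⟨
    ∣ X ∪ ⁅ e ⁆ ∣   ≤⟨ ∣p∣≤n (X ∪ ⁅ e ⁆) ⟩
    n               ≤⟨ n≤∣X∣+0 ⟩
    ∣ X ∣ + 0       ≡⟨ +-identityʳ _ ⟩
    ∣ X ∣           ∎) (<-irrefl refl)
    where open ≤-Reasoning
  go (suc k) X n≤∣X∣+1+k PX | yes (e , e∉X , Re) =
    go k (X ∪ ⁅ e ⁆) (subst (n ≤_) (trans (+-suc _ k) (cong (_+ k) (sym (∣p∪⁅x⁆∣≡1+∣p∣ e∉X)))) n≤∣X∣+1+k)
       (step PX Re)

Coloop : Matroid n → Subset n → Fin n → Set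
Coloop L X e = rank L (X - e) < rank L X

InClosure : Matroid n → Subset n → Fin n → Set
InClosure L X e = rank L (X ∪ ⁅ e ⁆) ≤ rank L X

SeparatingSet : Matroid n → Fin n → Fin n → Subset n → Set
SeparatingSet L x y X = x ∈ X × ¬ Coloop L X x × ¬ InClosure L X y

module _ (L : Matroid n) where
  open Matroid L using () renaming (rank to r)

  rank-mono : X ⊆ Y → r X ≤ r Y
  rank-mono = rank-mon L _ _

  rank-∪-≤ : ∀ X Y → r (X ∪ Y) ≤ r X + ∣ Y ∣
  rank-∪-≤ X Y = begin
    r (X ∪ Y)               ≤⟨ m≤m+n _ _ ⟩
    r (X ∪ Y) + r (X ∩ Y)   ≤⟨ rank-sub L X Y ⟩
    r X + r Y               ≤⟨ +-monoʳ-≤ (r X) (rank-≤ L Y) ⟩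
    r X + ∣ Y ∣             ∎
    where open ≤-Reasoning

  rank≤1+rank-del : ∀ X e → r X ≤ suc (r (X - e))
  rank≤1+rank-del X e = begin
    r X                     ≤⟨ rank-mono p⊆p-x∪⁅x⁆ ⟩
    r ((X - e) ∪ ⁅ e ⁆)     ≤⟨ rank-∪-≤ (X - e) ⁅ e ⁆ ⟩
    r (X - e) + ∣ ⁅ e ⁆ ∣   ≡⟨ cong (r (X - e) +_) (∣⁅x⁆∣≡1 e) ⟩
    r (X - e) + 1           ≡⟨ +-comm _ 1 ⟩
    suc (r (X - e))         ∎
    where open ≤-Reasoning

  coloop⇒rank≡1+rank-del : Coloop L X e → r X ≡ suc (r (X - e))
  coloop⇒rank≡1+rank-del {X = X} {e = e} = ≤-antisym (rank≤1+rank-del X e)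

  ¬coloop⇒rank-del≡rank : ¬ Coloop L X e → r (X - e) ≡ r X
  ¬coloop⇒rank-del≡rank {X = X} ¬coloop = ≤-antisym (rank-mono (p─q⊆p X _)) (≮⇒≥ ¬coloop)

  independent-⊆ : Y ⊆ X → Independent L X → Independent L Y
  independent-⊆ {Y = Y} {X = X} Y⊆X indX =
    ≤-antisym (rank-≤ L Y) (+-cancelʳ-≤ ∣ X ─ Y ∣ ∣ Y ∣ (r Y) (begin
    ∣ Y ∣ + ∣ X ─ Y ∣       ≤⟨ +-monoˡ-≤ _ (p⊆q⇒∣p∣≤∣q∣ (λ h → x∈p∩q⁺ (Y⊆X h , h))) ⟩
    ∣ X ∩ Y ∣ + ∣ X ─ Y ∣   ≡⟨ ∣p∣≡∣p∩q∣+∣p─q∣ X Y ⟨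
    ∣ X ∣                   ≡⟨ indX ⟨
    r X                     ≤⟨ rank-mono (p⊆q∪p─q Y) ⟩
    r (Y ∪ (X ─ Y))         ≤⟨ rank-∪-≤ Y (X ─ Y) ⟩
    r Y + ∣ X ─ Y ∣         ∎))
    where open ≤-Reasoning

  independent-add-coloop : e ∈ X → Coloop L X e → Independent L (X - e) → Independent L X
  independent-add-coloop {e = e} {X = X} e∈X coloop indX-e = begin
    r X               ≡⟨ coloop⇒rank≡1+rank-del coloop ⟩
    suc (r (X - e))   ≡⟨ cong suc indX-e ⟩
    suc ∣ X - e ∣     ≡⟨ ∣p∣≡1+∣p-x∣ e∈X ⟨
    ∣ X ∣             ∎
    where open ≡-Reasoning

  rank-submodular-⊆ : ∀ {U I} X Y → U ⊆ X ∪ Y → I ⊆ X ∩ Y → r U + r I ≤ r X + r Y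
  rank-submodular-⊆ X Y U⊆X∪Y I⊆X∩Y =
    ≤-trans (+-mono-≤ (rank-mono U⊆X∪Y) (rank-mono I⊆X∩Y)) (rank-sub L X Y)

  coloop-del : Coloop L X f → Coloop L X g → g ≢ f → Coloop L (X - f) g
  coloop-del {X = X} {f = f} {g = g} coloop-f coloop-g g≢f = +-cancelˡ-< (r X) _ _ (begin-strict
    r X + r (X - f - g)         ≤⟨ rank-submodular-⊆ (X - g) (X - f) (p⊆p-x∪p-y (g≢f ∘ sym)) p-x-y⊆p-y∩p-x ⟩
    r (X - g) + r (X - f)       <⟨ +-monoˡ-< (r (X - f)) coloop-g ⟩
    r X + r (X - f)             ∎)
    where open ≤-Reasoning

  ¬coloop-del : Coloop L X f → ¬ Coloop L X g → ¬ Coloop L (X - f) g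
  ¬coloop-del {X = X} {f = f} {g = g} coloop-f ¬coloop-g = ≤⇒≯ (s≤s⁻¹ (begin
    suc (r (X - f))       ≡⟨ coloop⇒rank≡1+rank-del coloop-f ⟨
    r X                   ≡⟨ ¬coloop⇒rank-del≡rank ¬coloop-g ⟨
    r (X - g)             ≤⟨ rank≤1+rank-del (X - g) f ⟩
    suc (r (X - g - f))   ≡⟨ cong (suc ∘ r) (p─x─y≡p─y─x X g f) ⟩
    suc (r (X - f - g))   ∎))
    where open ≤-Reasoning

  coloops⇒independent : (∀ f → f ∈ X → Coloop L X f) → Independent L X
  coloops⇒independent {X = X} = go _ X ≤-refl
    where
    go : ∀ k X → ∣ X ∣ ≤ k → (∀ f → f ∈ X → Coloop L X f) → Independent L X
    go k X _ coloops with nonempty? X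
    ... | no empty = trans (n≤0⇒n≡0 (subst (r X ≤_) ∣X∣≡0 (rank-≤ L X))) (sym ∣X∣≡0)
      where
      ∣X∣≡0 : ∣ X ∣ ≡ 0
      ∣X∣≡0 = trans (cong ∣_∣ (Empty-unique empty)) (∣⊥∣≡0 n)
    go zero X ∣X∣≤0 _ | yes (f , f∈X) = contradiction (≤-trans (x∈p⇒∣p-x∣<∣p∣ f∈X) ∣X∣≤0) n≮0
    go (suc k) X ∣X∣≤1+k coloops | yes (f , f∈X) = independent-add-coloop f∈X (coloops f f∈X)
      (go k (X - f) (≤-pred (≤-trans (x∈p⇒∣p-x∣<∣p∣ f∈X) ∣X∣≤1+k)) λ g g∈X-f →
        coloop-del (coloops f f∈X) (coloops g (p─q⊆p X _ g∈X-f)) (x∈p-y⇒x≢y X g∈X-f))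

  closure-mono : Y ⊆ X → InClosure L Y e → InClosure L X e
  closure-mono {Y = Y} {X = X} {e = e} Y⊆X e∈clY = +-cancelʳ-≤ (r Y) _ _ (begin
    r (X ∪ ⁅ e ⁆) + r Y         ≤⟨ rank-submodular-⊆ X (Y ∪ ⁅ e ⁆) (∪-mono-⊆ ⊆-refl (q⊆p∪q Y ⁅ e ⁆))
                                                     (λ h → x∈p∩q⁺ (Y⊆X h , p⊆p∪q _ h)) ⟩
    r X + r (Y ∪ ⁅ e ⁆)         ≤⟨ +-monoʳ-≤ (r X) e∈clY ⟩
    r X + r Y                   ∎)
    where open ≤-Reasoning

  ∈⇒InClosure : e ∈ X → InClosure L X e
  ∈⇒InClosure {X = X} e∈X =
    rank-mono (⊆-trans (∪-mono-⊆ ⊆-refl (x∈p⇒⁅x⁆⊆p e∈X)) (⊆-reflexive (∪-idem X)))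

  flat-del-coloop : Flat L X → Coloop L X f → Flat L (X - f)
  flat-del-coloop {X = X} {f = f} flat coloop e e∉X-f with e ≟ᶠ f
  ... | yes refl = <-≤-trans coloop (rank-mono p⊆p-x∪⁅x⁆)
  ... | no e≢f   = ≰⇒> λ e∈cl[X-f] → <⇒≱ (flat e e∉X) (closure-mono (p─q⊆p X _) e∈cl[X-f])
    where
    e∉X : e ∉ X
    e∉X e∈X = e∉X-f (x∈p∧x≢y⇒x∈p-y e∈X e≢f)

  circuit-of-minimal : e ∈ C → ¬ Coloop L C e → (∀ f → f ∈ C → f ≢ e → Coloop L (C - f) e) → Circuit L C
  circuit-of-minimal {e = e} {C = C} e∈C ¬coloop-e minimal = dependent , proper⇒independent
    where
    independent-C-e : Independent L (C - e)
    independent-C-e = coloops⇒independent λ f f∈C-e → begin-strict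
      r (C - e - f)     ≡⟨ cong r (p─x─y≡p─y─x C e f) ⟩
      r (C - f - e)     <⟨ minimal f (p─q⊆p C _ f∈C-e) (x∈p-y⇒x≢y C f∈C-e) ⟩
      r (C - f)         ≤⟨ rank-mono (p─q⊆p C _) ⟩
      r C               ≡⟨ ¬coloop⇒rank-del≡rank ¬coloop-e ⟨
      r (C - e)         ∎
      where open ≤-Reasoning

    dependent : Dependent L C
    dependent = begin-strict
      r C               ≡⟨ ¬coloop⇒rank-del≡rank ¬coloop-e ⟨
      r (C - e)         ≡⟨ independent-C-e ⟩
      ∣ C - e ∣         <⟨ n<1+n _ ⟩
      suc ∣ C - e ∣     ≡⟨ ∣p∣≡1+∣p-x∣ e∈C ⟨
      ∣ C ∣             ∎
      where open ≤-Reasoning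

    proper⇒independent : ∀ D → D ⊂ C → Independent L D
    proper⇒independent D (D⊆C , f , f∈C , f∉D) with e ∈? D
    ... | no e∉D  = independent-⊆ (p⊆q∧x∉p⇒p⊆q-x D⊆C e∉D) independent-C-e
    ... | yes e∈D = independent-⊆ (p⊆q∧x∉p⇒p⊆q-x D⊆C f∉D)
      (independent-add-coloop (x∈p∧x≢y⇒x∈p-y e∈C (f≢e ∘ sym)) (minimal f f∈C f≢e)
        (independent-⊆ (p⊆q⇒p-x⊆q-x (p─q⊆p C _)) independent-C-e))
      where
      f≢e : f ≢ e
      f≢e refl = f∉D e∈D

  circuit-through : e ∈ X → ¬ Coloop L X e → ∃ λ C → Circuit L C × C ⊆ X × e ∈ C
  circuit-through {e = e} e∈X ¬coloop-e
    with descend (λ C → e ∈ C × ¬ Coloop L C e) (λ C f → f ≢ e × ¬ Coloop L (C - f) e)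
                 (λ C f → ¬? (f ≟ᶠ e) ×-dec ¬? (r (C - f - e) <? r (C - f)))
                 (λ (e∈C , _) (f≢e , ¬coloop) → x∈p∧x≢y⇒x∈p-y e∈C (f≢e ∘ sym) , ¬coloop)
                 (e∈X , ¬coloop-e)
  ... | C , C⊆X , (e∈C , ¬coloop-C-e) , minimal =
    C , circuit-of-minimal e∈C ¬coloop-C-e coloop-after-del , C⊆X , e∈C
    where
    coloop-after-del : ∀ f → f ∈ C → f ≢ e → Coloop L (C - f) e
    coloop-after-del f f∈C f≢e = decidable-stable (_ <? _) λ ¬coloop → minimal f f∈C (f≢e , ¬coloop)

  coloopFree-flat⇒cyclicFlat : Flat L Z → (∀ e → e ∈ Z → ¬ Coloop L Z e) → CyclicFlat L Z
  coloopFree-flat⇒cyclicFlat flat coloopFree = flat , λ e e∈Z → circuit-through e∈Z (coloopFree e e∈Z)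

  closure⊆flat : Flat L Z → C ⊆ Z → InClosure L C e → e ∈ Z
  closure⊆flat {Z = Z} {e = e} flat C⊆Z e∈clC with e ∈? Z
  ... | yes e∈Z = e∈Z
  ... | no e∉Z  = contradiction (closure-mono C⊆Z e∈clC) (<⇒≱ (flat e e∉Z))

restrict-dot-matched : ∀ {A B : Subset n} (r : RankFn n) → A ∪ B ≡ ⊤ →
                       Matched (restrictRk r A) (dotRk r B) A B
restrict-dot-matched {A = A} {B = B} r A∪B≡⊤ Y Y⊆A∩B =
  cong₂ (λ S T → r S ∸ r T) (trans [Y∪A─B]∩A≡Y∪∁B (sym (p∩q∪∁q≡p∪∁q Y B))) (p∪q≡⊤⇒[p─q]∩p≡∁q A∪B≡⊤)
  where
  [Y∪A─B]∩A≡Y∪∁B : (Y ∪ (A ─ B)) ∩ A ≡ Y ∪ ∁ B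
  [Y∪A─B]∩A≡Y∪∁B = ⊆-antisym forward backward
    where
    forward : (Y ∪ (A ─ B)) ∩ A ⊆ Y ∪ ∁ B
    forward h with x∈p∪q⁻ Y (A ─ B) (proj₁ (x∈p∩q⁻ _ A h))
    ... | inj₁ i∈Y   = x∈p∪q⁺ (inj₁ i∈Y)
    ... | inj₂ i∈A─B = x∈p∪q⁺ (inj₂ (x∉p⇒x∈∁p (x∈p─q⇒x∉q A B i∈A─B)))
    backward : Y ∪ ∁ B ⊆ (Y ∪ (A ─ B)) ∩ A
    backward h with x∈p∪q⁻ Y (∁ B) h
    ... | inj₁ i∈Y  = x∈p∩q⁺ (x∈p∪q⁺ (inj₁ i∈Y) , proj₁ (x∈p∩q⁻ A B (Y⊆A∩B i∈Y)))
    ... | inj₂ i∈∁B = let i∉B = x∈∁p⇒x∉p i∈∁B ; i∈A = p∪q≡⊤∧x∉q⇒x∈p A∪B≡⊤ i∉B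
                      in x∈p∩q⁺ (x∈p∪q⁺ (inj₂ (x∈p∧x∉q⇒x∈p─q i∈A i∉B)) , i∈A)

module _ (L : Matroid n) where
  open Matroid L using () renaming (rank to r)

  freeSpliceRk-restrict-dot : ∀ {A B} → A ∪ B ≡ ⊤ → ∀ X →
    freeSpliceRk (restrictRk r A) (dotRk r B) A B X ≡ (r (X ∩ A) + ∣ X ─ A ∣) ⊓ r (X ∪ ∁ B)
  freeSpliceRk-restrict-dot {A} {B} A∪B≡⊤ X =
    cong₂ _⊓_ (cong (λ S → r S + ∣ X ─ A ∣) (p∩q∩q≡p∩q X A)) (begin
      r ((X ∩ B) ∩ B ∪ ∁ B) ∸ r (∁ B) + r ((A ─ B) ∩ A)
        ≡⟨ cong₂ (λ S T → r S ∸ r (∁ B) + r T)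
                 (trans (cong (_∪ ∁ B) (p∩q∩q≡p∩q X B)) (p∩q∪∁q≡p∪∁q X B))
                 (p∪q≡⊤⇒[p─q]∩p≡∁q A∪B≡⊤) ⟩
      r (X ∪ ∁ B) ∸ r (∁ B) + r (∁ B)
        ≡⟨ m∸n+n≡m (rank-mono L (x∈p∪q⁺ ∘ inj₂)) ⟩
      r (X ∪ ∁ B) ∎)
    where open ≡-Reasoning

  freeSeparator⇔ : ∀ {A B} → FreeSeparator L A B ⇔
    (A ∪ B ≡ ⊤ × ∀ X → r X ≡ (r (X ∩ A) + ∣ X ─ A ∣) ⊓ r (X ∪ ∁ B))
  freeSeparator⇔ = mk⇔
    (λ (A∪B≡⊤ , _ , rank≡) → A∪B≡⊤ , λ X → trans (rank≡ X) (freeSpliceRk-restrict-dot A∪B≡⊤ X))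
    (λ (A∪B≡⊤ , rank≡) → A∪B≡⊤ , restrict-dot-matched r A∪B≡⊤ ,
       λ X → trans (rank≡ X) (sym (freeSpliceRk-restrict-dot A∪B≡⊤ X)))

  circuit-spans-∁ : ∀ {A B} → FreeSeparator L A B → Circuit L C → x ∈ C → x ∉ A → r (C ∪ ∁ B) ≡ r C
  circuit-spans-∁ {C = C} {x = x} {A = A} {B = B} separator (dependent , minimal) x∈C x∉A =
    [ (λ rank≡split → contradiction (trans (rank≡ C) (trans rank≡split split≡∣C∣)) (<⇒≢ dependent))
    , (λ rank≡span → sym (trans (rank≡ C) rank≡span))
    ]′ (⊓-sel (r (C ∩ A) + ∣ C ─ A ∣) (r (C ∪ ∁ B)))
    where
    rank≡ = proj₂ (Equivalence.to freeSeparator⇔ separator)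
    C∩A⊂C : C ∩ A ⊂ C
    C∩A⊂C = p∩q⊆p C A , x , x∈C , x∉A ∘ proj₂ ∘ x∈p∩q⁻ C A
    split≡∣C∣ : r (C ∩ A) + ∣ C ─ A ∣ ≡ ∣ C ∣
    split≡∣C∣ = trans (cong (_+ ∣ C ─ A ∣) (minimal (C ∩ A) C∩A⊂C)) (sym (∣p∣≡∣p∩q∣+∣p─q∣ C A))

  separatingCyclicFlats⇒irreducible :
    (∀ x y → x ≢ y → ∃ λ Z → CyclicFlat L Z × x ∈ Z × y ∉ Z) → Irreducible L
  separatingCyclicFlats⇒irreducible separate (A , B , separator , (y , y∈A─B) , (x , x∈B─A))
    with separate x y (λ { refl → x∈p─q⇒x∉q B A x∈B─A (p─q⊆p A B y∈A─B) })
  ... | Z , (flat , cyclic) , x∈Z , y∉Z with cyclic x x∈Z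
  ... | C , circuit , C⊆Z , x∈C = y∉Z (closure⊆flat L flat C⊆Z (begin
    r (C ∪ ⁅ y ⁆)   ≤⟨ rank-mono L (∪-mono-⊆ ⊆-refl (x∈p⇒⁅x⁆⊆p (x∉p⇒x∈∁p (x∈p─q⇒x∉q A B y∈A─B)))) ⟩
    r (C ∪ ∁ B)     ≡⟨ circuit-spans-∁ separator circuit x∈C (x∈p─q⇒x∉q B A x∈B─A) ⟩
    r C             ∎))
    where open ≤-Reasoning

  separatingSet? : ∀ x y X → Dec (SeparatingSet L x y X)
  separatingSet? x y X = x ∈? X ×-dec ¬? (_ <? _) ×-dec ¬? (_ ≤? _)

  separatingSet-∪ : SeparatingSet L x y X → InClosure L X e → SeparatingSet L x y (X ∪ ⁅ e ⁆)
  separatingSet-∪ {x = x} {y = y} {X = X} {e = e} (x∈X , ¬coloop , y∉clX) e∈clX =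
    p⊆p∪q _ x∈X , ≤⇒≯ rank≤rank-del , λ y∈cl → y∉clX (begin
      r (X ∪ ⁅ y ⁆)             ≤⟨ rank-mono L (∪-mono-⊆ (p⊆p∪q _) ⊆-refl) ⟩
      r ((X ∪ ⁅ e ⁆) ∪ ⁅ y ⁆)   ≤⟨ y∈cl ⟩
      r (X ∪ ⁅ e ⁆)             ≤⟨ e∈clX ⟩
      r X                       ∎)
    where
    open ≤-Reasoning
    rank≤rank-del : r (X ∪ ⁅ e ⁆) ≤ r (X ∪ ⁅ e ⁆ - x)
    rank≤rank-del = begin
      r (X ∪ ⁅ e ⁆)             ≤⟨ e∈clX ⟩
      r X                       ≡⟨ ¬coloop⇒rank-del≡rank L ¬coloop ⟨
      r (X - x)                 ≤⟨ rank-mono L (p⊆q⇒p-x⊆q-x (p⊆p∪q _)) ⟩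
      r (X ∪ ⁅ e ⁆ - x)         ∎

  separatingSet⇒separatingFlat : SeparatingSet L x y X → ∃ λ Z → Flat L Z × SeparatingSet L x y Z
  separatingSet⇒separatingFlat {x = x} {y = y} separating
    with ascend (SeparatingSet L x y) (InClosure L) (λ X e → _ ≤? _) separatingSet-∪ separating
  ... | Z , separatingZ , closed = Z , (λ e e∉Z → ≰⇒> (closed e e∉Z)) , separatingZ

  separatingFlat⇒separatingCyclicFlat : Flat L Z → x ∈ Z → ¬ Coloop L Z x → y ∉ Z →
                                        ∃ λ Z′ → CyclicFlat L Z′ × x ∈ Z′ × y ∉ Z′
  separatingFlat⇒separatingCyclicFlat {x = x} {y = y} flat x∈Z ¬coloop y∉Z
    with descend (λ Z → Flat L Z × x ∈ Z × ¬ Coloop L Z x × y ∉ Z) (Coloop L) (λ Z f → _ <? _)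
                 (λ (flat , x∈Z , ¬coloop , y∉Z) coloop-f →
                    flat-del-coloop L flat coloop-f ,
                    x∈p∧x≢y⇒x∈p-y x∈Z (λ { refl → ¬coloop coloop-f }) ,
                    ¬coloop-del L coloop-f ¬coloop ,
                    y∉Z ∘ p─q⊆p _ _)
                 (flat , x∈Z , ¬coloop , y∉Z)
  ... | Z′ , _ , (flat′ , x∈Z′ , _ , y∉Z′) , coloopFree =
    Z′ , coloopFree-flat⇒cyclicFlat L flat′ coloopFree , x∈Z′ , y∉Z′

  separatingSet⇒separatingCyclicFlat : SeparatingSet L x y X → ∃ λ Z → CyclicFlat L Z × x ∈ Z × y ∉ Z
  separatingSet⇒separatingCyclicFlat separating with separatingSet⇒separatingFlat separating
  ... | Z , flat , x∈Z , ¬coloop , y∉clZ =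
    separatingFlat⇒separatingCyclicFlat flat x∈Z ¬coloop (y∉clZ ∘ ∈⇒InClosure L)

  a≡rank⇒rank≡a⊓rank-∪ : ∀ {a} → a ≡ r X → r X ≡ a ⊓ r (X ∪ ⁅ y ⁆)
  a≡rank⇒rank≡a⊓rank-∪ a≡r = sym (trans (m≤n⇒m⊓n≡m (≤-trans (≤-reflexive a≡r) (rank-mono L (p⊆p∪q _)))) a≡r)

  rank≡deletion-splice : (∀ X → ¬ SeparatingSet L x y X) →
                         ∀ X → r X ≡ (r (X - x) + ∣ X ∩ ⁅ x ⁆ ∣) ⊓ r (X ∪ ⁅ y ⁆)
  rank≡deletion-splice {x = x} {y = y} none X with x ∈? X
  ... | no x∉X = a≡rank⇒rank≡a⊓rank-∪ (begin
    r (X - x) + ∣ X ∩ ⁅ x ⁆ ∣   ≡⟨ cong₂ _+_ (cong r (p-x≡p x∉X)) (trans (cong ∣_∣ (p∩⁅x⁆≡⊥ x∉X)) (∣⊥∣≡0 n)) ⟩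
    r X + 0                     ≡⟨ +-identityʳ _ ⟩
    r X                         ∎)
    where open ≡-Reasoning
  ... | yes x∈X with r (X - x) <? r X
  ...   | yes coloop = a≡rank⇒rank≡a⊓rank-∪ (begin
    r (X - x) + ∣ X ∩ ⁅ x ⁆ ∣   ≡⟨ cong (r (X - x) +_) (trans (cong ∣_∣ (p∩⁅x⁆≡⁅x⁆ x∈X)) (∣⁅x⁆∣≡1 x)) ⟩
    r (X - x) + 1               ≡⟨ +-comm _ 1 ⟩
    suc (r (X - x))             ≡⟨ coloop⇒rank≡1+rank-del L coloop ⟨
    r X                         ∎)
    where open ≡-Reasoning
  ...   | no ¬coloop = sym (trans (m≥n⇒m⊓n≡n (begin
    r (X ∪ ⁅ y ⁆)               ≤⟨ y∈clX ⟩
    r X                         ≤⟨ m≤m+n _ _ ⟩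
    r X + ∣ X ∩ ⁅ x ⁆ ∣         ≡⟨ cong (_+ ∣ X ∩ ⁅ x ⁆ ∣) (¬coloop⇒rank-del≡rank L ¬coloop) ⟨
    r (X - x) + ∣ X ∩ ⁅ x ⁆ ∣   ∎)) (≤-antisym y∈clX (rank-mono L (p⊆p∪q _))))
    where
    open ≤-Reasoning
    y∈clX : InClosure L X y
    y∈clX = decidable-stable (_ ≤? _) λ y∉clX → none X (x∈X , ¬coloop , y∉clX)

  noSeparatingSet⇒reducible : x ≢ y → (∀ X → ¬ SeparatingSet L x y X) → Reducible L
  noSeparatingSet⇒reducible {x = x} {y = y} x≢y none =
    ∁ ⁅ x ⁆ , ∁ ⁅ y ⁆ ,
    Equivalence.from freeSeparator⇔
      (∁⁅x⁆∪∁⁅y⁆≡⊤ x≢y , λ X → trans (rank≡deletion-splice none X) (sym (splice≡ X))) ,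
    (y , y∈∁⁅x⁆─∁⁅y⁆ (x≢y ∘ sym)) , (x , y∈∁⁅x⁆─∁⁅y⁆ x≢y)
    where
    splice≡ : ∀ X → (r (X ∩ ∁ ⁅ x ⁆) + ∣ X ─ ∁ ⁅ x ⁆ ∣) ⊓ r (X ∪ ∁ (∁ ⁅ y ⁆))
                  ≡ (r (X - x) + ∣ X ∩ ⁅ x ⁆ ∣) ⊓ r (X ∪ ⁅ y ⁆)
    splice≡ X = cong₂ _⊓_ (cong₂ (λ S T → r S + ∣ T ∣) (p∩∁q≡p─q X ⁅ x ⁆) (p─∁q≡p∩q X ⁅ x ⁆))
                          (cong (λ S → r (X ∪ S)) (∁-involutive ⁅ y ⁆))

corollary4p4 : ∀ {n : ℕ} (L : Matroid n) →
    Irreducible L ⇔ (∀ (x y : Fin n) → x ≢ y → ∃ λ Z → CyclicFlat L Z × x ∈ Z × y ∉ Z)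
corollary4p4 L = mk⇔ irreducible⇒separated (separatingCyclicFlats⇒irreducible L)
  where
  irreducible⇒separated : Irreducible L → ∀ x y → x ≢ y → ∃ λ Z → CyclicFlat L Z × x ∈ Z × y ∉ Z
  irreducible⇒separated irreducible x y x≢y with anySubset? (separatingSet? L x y)
  ... | yes (X , separating) = separatingSet⇒separatingCyclicFlat L separating
  ... | no none = contradiction (noSeparatingSet⇒reducible L x≢y (curry none)) irreducible
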